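{- Let $G$ be a hole-with-hat-free graph. Let $C,D$ be disjoint nonempty subsets of $V(G)$, complete to each other, such that $C$ is connected and anticonnected, and $D$ is anticonnected. Let $P$ be a connected subgraph of $G$ with $V(P)\cap(C\cup D)=\emptyset$, such that some vertex of $P$ has a neighbour in $C$, and no vertex of $P$ is complete to $C$. Then no vertex of $P$ is mixed on $D$.
   Context: Graphs are finite and simple. A hole is an induced cycle of length at least four; a hole-with-hat is the subgraph induced by a hole $C$ together with a vertex $v\notin V(C)$ having exactly two neighbours in $V(C)$, these being adjacent; $G$ is hole-with-hat-free if it has no hole-with-hat. Sets are complete to each other if all edges between them are present, anticomplete if none are. $X$ is connected if $G[X]$ is connected, anticonnected if the complement of $G[X]$ is connected. A vertex $v\notin C$ is mixed on $C$ if it is neither complete nor anticomplete to $C$. -}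

module Defs where

open import Data.Nat using (ℕ; suc; _+_; _%_)
open import Data.Bool using (Bool; true; false)
open import Data.Fin using (Fin; toℕ)
open import Data.Fin.Subset using (Subset; _∈_; _∉_)
open import Data.Product using (Σ; ∃; _×_; _,_)
open import Data.Sum using (_⊎_)
open import Relation.Nullary using (¬_)
open import Relation.Binary.PropositionalEquality using (_≡_; _≢_)
open import Function using (_⇔_)
open import Function.Definitions using (Injective)

record Graph : Set where
  field
    n      : ℕ
    adj    : Fin n → Fin n → Bool
    sym    : ∀ u v → adj u v ≡ adj v u
    irrefl : ∀ v → adj v v ≡ false

module _ (G : Graph) where
  open Graph G

  V : Set
  V = Fin n

  Adj : V → V → Set
  Adj u v = adj u v ≡ true

  NonAdj : V → V → Set
  NonAdj u v = (u ≢ v) × ¬ Adj u v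

  -- two consecutive positions on a cycle of length k (k ≥ 4 ensures k ≠ 0)
  Consec : (m : ℕ) → Fin (4 + m) → Fin (4 + m) → Set
  Consec m i j = toℕ j ≡ (suc (toℕ i)) % (4 + m)

  CycAdj : (m : ℕ) → Fin (4 + m) → Fin (4 + m) → Set
  CycAdj m i j = Consec m i j ⊎ Consec m j i

  IsHole : (m : ℕ) → (Fin (4 + m) → V) → Set
  IsHole m c = Injective _≡_ _≡_ c × (∀ i j → (Adj (c i) (c j) ⇔ CycAdj m i j))

  IsHat : (m : ℕ) → (Fin (4 + m) → V) → V → Set
  IsHat m c v =
    (∀ l → v ≢ c l) ×
    Σ (Fin (4 + m)) λ i → Σ (Fin (4 + m)) λ j →
      Consec m i j × Adj v (c i) × Adj v (c j) ×
      (∀ l → Adj v (c l) → (l ≡ i) ⊎ (l ≡ j))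

  HasHoleWithHat : Set
  HasHoleWithHat = Σ ℕ λ m → Σ (Fin (4 + m) → V) λ c → Σ V λ v →
    IsHole m c × IsHat m c v

  HoleWithHatFree : Set
  HoleWithHatFree = ¬ HasHoleWithHat

  data PathIn (R : V → V → Set) (X : Subset n) : V → V → Set where
    here : ∀ {u} → PathIn R X u u
    step : ∀ {u w v} → R u w → w ∈ X → PathIn R X w v → PathIn R X u v

  ConnectedBy : (R : V → V → Set) → Subset n → Set
  ConnectedBy R X = ∀ u v → u ∈ X → v ∈ X → PathIn R X u v

  Connected : Subset n → Set
  Connected X = ConnectedBy Adj X

  Anticonnected : Subset n → Set
  Anticonnected X = ConnectedBy NonAdj X

  record Subgraph : Set₁ where
    field
      VP    : Subset n
      EP    : V → V → Set
      EP⊆   : ∀ {u v} → EP u v → Adj u v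
      EPsym : ∀ {u v} → EP u v → EP v u
      EPV   : ∀ {u v} → EP u v → (u ∈ VP) × (v ∈ VP)

  SubgraphConnected : Subgraph → Set
  SubgraphConnected P = ConnectedBy (Subgraph.EP P) (Subgraph.VP P)

  Nonempty : Subset n → Set
  Nonempty X = ∃ λ v → v ∈ X

  Disjoint : Subset n → Subset n → Set
  Disjoint X Y = ∀ v → v ∈ X → v ∉ Y

  CompleteSets : Subset n → Subset n → Set
  CompleteSets X Y = ∀ x y → x ∈ X → y ∈ Y → Adj x y

  CompleteTo : V → Subset n → Set
  CompleteTo v X = ∀ x → x ∈ X → Adj v x

  AnticompleteTo : V → Subset n → Set
  AnticompleteTo v X = ∀ x → x ∈ X → ¬ Adj v x

  HasNbrIn : V → Subset n → Set
  HasNbrIn v X = ∃ λ x → x ∈ X × Adj v x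

  MixedOn : V → Subset n → Set
  MixedOn v X = v ∉ X × ¬ CompleteTo v X × ¬ AnticompleteTo v X

module Submission where

-- Suppose p ∈ P is mixed on D.  Following a walk in P from a
-- vertex with a neighbour in C to p, we extract an APPROACH: an induced path
-- r 0, …, r k of P ending at p in which only r 0 has a neighbour in C.  We
-- show by induction on k that no vertex r k of an approach is mixed on D.
--   * k = 0: r 0 has a neighbour and a non-neighbour in C, hence (C being
--     anticonnected) a non-adjacent pair c₁ ∈ N(r 0), c₂ ∉ N(r 0); likewise
--     d₁, d₂ in D.  Then c₁ d₁ c₂ d₂ is a 4-hole with hat r 0.
--   * k > 0, with d₁ ∈ N(r k), d₂ ∉ N(r k) non-adjacent in D:
--     if r (k-1) sees d₁ it is complete to D (it is not mixed, by induction),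
--     and r (k-1) d₁ c₀ d₂ is a 4-hole with hat r k, for c₀ ∈ C missed by
--     r (k-1);  otherwise extend the approach backwards by an edge c' c of C
--     with c ∈ N(r 0), c' ∉ N(r 0); d₁ sees the first two and the last vertex
--     of this induced path but not the one before last, and the first gap in
--     its neighbourhood along the path closes up to a hole with a hat.

open import Defs
open import Data.Nat using (ℕ; zero; suc; _+_; _∸_; _<_; _≤_; z≤n; s≤s; _%_)
open import Data.Nat.Properties
open import Data.Nat.DivMod using (m<n⇒m%n≡m; n%n≡0)
open import Data.Bool using (true)
open import Data.Bool.Properties using () renaming (_≟_ to _≟ᵇ_)
open import Data.Fin using (Fin; toℕ; zero; suc)
open import Data.Fin.Properties using (toℕ-injective; toℕ<n; any?) renaming (_≟_ to _≟ᶠ_)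
open import Data.Fin.Subset using (Subset; _∈_)
open import Data.Fin.Subset.Properties using (_∈?_)
open import Data.Product using (∃; ∃₂; _×_; _,_; proj₁; proj₂)
open import Data.Sum using (_⊎_; inj₁; inj₂; swap)
open import Data.Empty using (⊥; ⊥-elim)
open import Relation.Nullary using (¬_; Dec; yes; no)
open import Relation.Nullary.Decidable using (_×-dec_; _⊎-dec_; ¬?; decidable-stable)
open import Relation.Unary using (Decidable)
open import Relation.Binary.PropositionalEquality
open import Relation.Binary.Definitions using (tri<; tri≈; tri>)
open import Function using (_⇔_; mk⇔; Equivalence)
open import Function.Definitions using (Injective)

least : {P : ℕ → Set} → Decidable P → ∀ {n} → P n →
        ∃ λ m → m ≤ n × P m × (∀ {j} → j < m → ¬ P j)
least P? {zero} p = 0 , z≤n , p , λ ()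
least {P} P? {suc n} p with P? 0
... | yes p₀ = 0 , z≤n , p₀ , λ ()
... | no ¬p₀ with least {λ i → P (suc i)} (λ i → P? (suc i)) {n} p
...   | m , m≤n , pm , below = suc m , s≤s m≤n , pm , earlier
  where
  earlier : ∀ {j} → j < suc m → ¬ P j
  earlier {zero}  _         = ¬p₀
  earlier {suc j} (s≤s j<m) = below j<m

lastWitness : {P : ℕ → Set} → Decidable P → P 0 → ∀ m →
              ∃ λ j → j ≤ m × P j × (∀ {i} → j < i → i ≤ m → ¬ P i)
lastWitness P? p₀ zero = 0 , z≤n , p₀ , λ 0<i i≤0 _ → <⇒≱ 0<i i≤0
lastWitness {P} P? p₀ (suc m) with P? (suc m)
... | yes p = suc m , ≤-refl , p , λ j<i i≤ _ → <⇒≱ j<i i≤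
... | no ¬p with lastWitness P? p₀ m
...   | j , j≤m , pj , above = j , m≤n⇒m≤1+n j≤m , pj , later
  where
  later : ∀ {i} → j < i → i ≤ suc m → ¬ P i
  later {i} j<i i≤ with m≤n⇒m<n∨m≡n i≤
  ... | inj₁ i<  = above j<i (≤-pred i<)
  ... | inj₂ i≡  = subst (λ x → ¬ P x) (sym i≡) ¬p

cyclicSuccessor : ∀ {L x y} → x < suc L → y < suc L →
                  (y ≡ suc x % suc L) ⇔ ((y ≡ suc x) ⊎ (x ≡ L × y ≡ 0))
cyclicSuccessor {L} {x} {y} x<L+1 y<L+1 with m≤n⇒m<n∨m≡n x<L+1
... | inj₁ x+1<L+1 = mk⇔ (λ y≡ → inj₁ (trans y≡ x+1%≡)) from
  where
  x+1%≡ : suc x % suc L ≡ suc x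
  x+1%≡ = m<n⇒m%n≡m x+1<L+1
  from : (y ≡ suc x) ⊎ (x ≡ L × y ≡ 0) → y ≡ suc x % suc L
  from (inj₁ y≡)      = trans y≡ (sym x+1%≡)
  from (inj₂ (x≡ , _)) = ⊥-elim (<-irrefl (cong suc x≡) x+1<L+1)
... | inj₂ x+1≡L+1 = mk⇔ (λ y≡ → inj₂ (suc-injective x+1≡L+1 , trans y≡ x+1%≡)) from
  where
  x+1%≡ : suc x % suc L ≡ 0
  x+1%≡ = trans (cong (_% suc L) x+1≡L+1) (n%n≡0 (suc L))
  from : (y ≡ suc x) ⊎ (x ≡ L × y ≡ 0) → y ≡ suc x % suc L
  from (inj₁ y≡)       = ⊥-elim (<-irrefl x+1≡L+1 (subst (_< suc L) y≡ y<L+1))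
  from (inj₂ (_ , y≡0)) = trans y≡0 (sym x+1%≡)

module GraphFacts (G : Graph) where
  open Graph G using (n; adj)

  infix 4 _~_
  _~_ : V G → V G → Set
  u ~ v = Adj G u v

  ~-sym : ∀ {u v} → u ~ v → v ~ u
  ~-sym {u} {v} uv = trans (sym (Graph.sym G u v)) uv

  ~-irrefl : ∀ {u} → ¬ u ~ u
  ~-irrefl {u} uu with trans (sym (Graph.irrefl G u)) uu
  ... | ()

  ~⇒≢ : ∀ {u v} → u ~ v → u ≢ v
  ~⇒≢ uv refl = ~-irrefl uv

  _~?_ : ∀ u v → Dec (u ~ v)
  u ~? v = adj u v ≟ᵇ true

  hasNbr? : ∀ v X → Dec (HasNbrIn G v X)
  hasNbr? v X = any? (λ x → (x ∈? X) ×-dec (v ~? x))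

  missedVertex : ∀ v X → ¬ CompleteTo G v X → ∃ λ x → x ∈ X × ¬ v ~ x
  missedVertex v X incomplete with any? (λ x → (x ∈? X) ×-dec ¬? (v ~? x))
  ... | yes found = found
  ... | no none   = ⊥-elim (incomplete complete)
    where
    complete : CompleteTo G v X
    complete x x∈X with v ~? x
    ... | yes vx  = vx
    ... | no ¬vx = ⊥-elim (none (x , x∈X , ¬vx))

  someNeighbour : ∀ v X → ¬ AnticompleteTo G v X → HasNbrIn G v X
  someNeighbour v X ¬anti with hasNbr? v X
  ... | yes nbr  = nbr
  ... | no ¬nbr = ⊥-elim (¬anti λ x x∈X vx → ¬nbr (x , x∈X , vx))

  BoundaryEdge : (V G → V G → Set) → Subset n → V G → Set
  BoundaryEdge R X v = ∃₂ λ x x' → x ∈ X × x' ∈ X × v ~ x × ¬ v ~ x' × R x x'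

  crossing : ∀ {R X v x y} → PathIn G R X x y → x ∈ X → v ~ x → ¬ v ~ y → BoundaryEdge R X v
  crossing here _ vx ¬vy = ⊥-elim (¬vy vx)
  crossing {v = v} {x = x} (step {w = w} xw w∈X rest) x∈X vx ¬vy with v ~? w
  ... | yes vw  = crossing rest w∈X vw ¬vy
  ... | no ¬vw = x , w , x∈X , w∈X , vx , ¬vw , xw

  boundaryEdge : ∀ R X → ConnectedBy G R X → ∀ v → HasNbrIn G v X → ¬ CompleteTo G v X →
                 BoundaryEdge R X v
  boundaryEdge R X conn v (x , x∈X , vx) incomplete with missedVertex v X incomplete
  ... | y , y∈X , ¬vy = crossing (conn x y x∈X y∈X) x∈X vx ¬vy

  record InducedPath (r : ℕ → V G) (L : ℕ) : Set where
    field
      distinct  : ∀ {i j} → i ≤ L → j ≤ L → r i ≡ r j → i ≡ j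
      linked    : ∀ {i} → i < L → r i ~ r (suc i)
      chordless : ∀ {i j} → i < j → j ≤ L → r i ~ r j → j ≡ suc i

  Off : V G → (ℕ → V G) → ℕ → Set
  Off v r L = ∀ {i} → i ≤ L → v ≢ r i

  trivialPath : ∀ v → InducedPath (λ _ → v) 0
  trivialPath v = record
    { distinct  = λ i≤0 j≤0 _ → trans (n≤0⇒n≡0 i≤0) (sym (n≤0⇒n≡0 j≤0))
    ; linked    = λ ()
    ; chordless = λ i<j j≤0 _ → ⊥-elim (<⇒≱ (<-≤-trans i<j j≤0) z≤n) }

  shorten : ∀ {r L L'} → InducedPath r L → L' ≤ L → InducedPath r L'
  shorten π L'≤L = record
    { distinct  = λ i≤ j≤ → distinct (≤-trans i≤ L'≤L) (≤-trans j≤ L'≤L)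
    ; linked    = λ i< → linked (<-≤-trans i< L'≤L)
    ; chordless = λ i<j j≤ → chordless i<j (≤-trans j≤ L'≤L) }
    where open InducedPath π

  segment : ∀ {r L} → InducedPath r L → ∀ {j L'} → L' + j ≤ L → InducedPath (λ i → r (i + j)) L'
  segment {r} {L} π {j} {L'} fits = record
    { distinct  = λ i≤ i'≤ e → +-cancelʳ-≡ j _ _ (distinct (inside i≤) (inside i'≤) e)
    ; linked    = λ i< → linked (<-≤-trans (+-monoˡ-< j i<) fits)
    ; chordless = λ i<i' i'≤ a → +-cancelʳ-≡ j _ _ (chordless (+-monoˡ-< j i<i') (inside i'≤) a) }
    where
    open InducedPath π
    inside : ∀ {i} → i ≤ L' → i + j ≤ L
    inside i≤ = ≤-trans (+-monoˡ-≤ j i≤) fits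

  infixr 5 _◂_
  _◂_ : V G → (ℕ → V G) → ℕ → V G
  (u ◂ r) zero    = u
  (u ◂ r) (suc i) = r i

  extend : ∀ {u r L} → InducedPath r L → Off u r L → u ~ r 0 →
           (∀ {i} → 0 < i → i ≤ L → ¬ u ~ r i) → InducedPath (u ◂ r) (suc L)
  extend {u} {r} {L} π off u~r₀ onlyFirst =
    record { distinct = distinct′ ; linked = linked′ ; chordless = chordless′ }
    where
    open InducedPath π
    distinct′ : ∀ {i j} → i ≤ suc L → j ≤ suc L → (u ◂ r) i ≡ (u ◂ r) j → i ≡ j
    distinct′ {zero}  {zero}  _  _  _ = refl
    distinct′ {zero}  {suc j} _  j≤ e = ⊥-elim (off (≤-pred j≤) e)
    distinct′ {suc i} {zero}  i≤ _  e = ⊥-elim (off (≤-pred i≤) (sym e))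
    distinct′ {suc i} {suc j} i≤ j≤ e = cong suc (distinct (≤-pred i≤) (≤-pred j≤) e)
    linked′ : ∀ {i} → i < suc L → (u ◂ r) i ~ (u ◂ r) (suc i)
    linked′ {zero}  _  = u~r₀
    linked′ {suc i} i< = linked (≤-pred i<)
    chordless′ : ∀ {i j} → i < j → j ≤ suc L → (u ◂ r) i ~ (u ◂ r) j → j ≡ suc i
    chordless′ {j = zero} () _ _
    chordless′ {zero}  {suc zero}    _ _  _ = refl
    chordless′ {zero}  {suc (suc j)} _ j≤ a = ⊥-elim (onlyFirst (s≤s z≤n) (≤-pred j≤) a)
    chordless′ {suc i} {suc j} i<j j≤ a = cong suc (chordless (≤-pred i<j) (≤-pred j≤) a)

  threePath : ∀ {x y z} → x ~ y → y ~ z → NonAdj G x z → InducedPath (x ◂ y ◂ λ _ → z) 2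
  threePath {x} {y} {z} xy yz (x≢z , ¬xz) =
    extend (extend (trivialPath z) (λ _ → ~⇒≢ yz) yz (λ 0<i i≤0 → ⊥-elim (<⇒≱ 0<i i≤0)))
           offX xy onlyY
    where
    offX : Off x (y ◂ λ _ → z) 1
    offX {zero}  _ = ~⇒≢ xy
    offX {suc _} _ = x≢z
    onlyY : ∀ {i} → 0 < i → i ≤ 1 → ¬ x ~ (y ◂ λ _ → z) i
    onlyY {suc _} _ _ = ¬xz

  closeUp : (m : ℕ) → V G → (ℕ → V G) → Fin (4 + m) → V G
  closeUp m d s zero    = d
  closeUp m d s (suc i) = s (toℕ i)

  consec⇔ : ∀ m (i j : Fin (4 + m)) →
            Consec G m i j ⇔ ((toℕ j ≡ suc (toℕ i)) ⊎ (toℕ i ≡ 3 + m × toℕ j ≡ 0))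
  consec⇔ m i j = cyclicSuccessor (toℕ<n i) (toℕ<n j)

  toℕ≤ : ∀ {L} (i : Fin (suc L)) → toℕ i ≤ L
  toℕ≤ i = ≤-pred (toℕ<n i)

  closeUp-injective : ∀ {m s d} → InducedPath s (2 + m) → Off d s (2 + m) →
                      Injective _≡_ _≡_ (closeUp m d s)
  closeUp-injective π off {zero}  {zero}  _ = refl
  closeUp-injective π off {zero}  {suc j} e = ⊥-elim (off (toℕ≤ j) e)
  closeUp-injective π off {suc i} {zero}  e = ⊥-elim (off (toℕ≤ i) (sym e))
  closeUp-injective π off {suc i} {suc j} e =
    cong suc (toℕ-injective (InducedPath.distinct π (toℕ≤ i) (toℕ≤ j) e))

  closedPathIsHole : ∀ {m s d} → InducedPath s (2 + m) → Off d s (2 + m) →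
    d ~ s 0 → d ~ s (2 + m) → (∀ {i} → 0 < i → i < 2 + m → ¬ d ~ s i) →
    IsHole G m (closeUp m d s)
  closedPathIsHole {m} {s} {d} π off d~first d~last ¬d~inner =
    closeUp-injective π off , λ i j → mk⇔ (toCycle i j) (fromCycle i j)
    where
    open InducedPath π
    consec : ∀ {i j} → (toℕ j ≡ suc (toℕ i)) ⊎ (toℕ i ≡ 3 + m × toℕ j ≡ 0) → Consec G m i j
    consec {i} {j} = Equivalence.from (consec⇔ m i j)
    dEnds : ∀ {x} → x ≤ 2 + m → d ~ s x → (x ≡ 0) ⊎ (x ≡ 2 + m)
    dEnds {zero}  _  _ = inj₁ refl
    dEnds {suc x} x≤ a with m≤n⇒m<n∨m≡n x≤
    ... | inj₁ x< = ⊥-elim (¬d~inner (s≤s z≤n) x< a)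
    ... | inj₂ x≡ = inj₂ x≡
    fromD : ∀ j → d ~ s (toℕ j) → CycAdj G m zero (suc j)
    fromD j a with dEnds (toℕ≤ j) a
    ... | inj₁ j≡0    = inj₁ (consec (inj₁ (cong suc j≡0)))
    ... | inj₂ j≡last = inj₂ (consec (inj₂ (cong suc j≡last , refl)))
    chord : ∀ {i j} → toℕ i < toℕ j → s (toℕ i) ~ s (toℕ j) → Consec G m (suc i) (suc j)
    chord {i} {j} i<j a = consec (inj₁ (cong suc (chordless i<j (toℕ≤ j) a)))
    toCycle : ∀ i j → closeUp m d s i ~ closeUp m d s j → CycAdj G m i j
    toCycle zero    zero    a = ⊥-elim (~-irrefl a)
    toCycle zero    (suc j) a = fromD j a
    toCycle (suc i) zero    a = swap (fromD i (~-sym a))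
    toCycle (suc i) (suc j) a with <-cmp (toℕ i) (toℕ j)
    ... | tri< i<j _ _ = inj₁ (chord i<j a)
    ... | tri≈ _ i≡j _ = ⊥-elim (~-irrefl (subst (λ x → s (toℕ i) ~ s x) (sym i≡j) a))
    ... | tri> _ _ j<i = inj₂ (chord j<i (~-sym a))
    edge : ∀ i j → (toℕ j ≡ suc (toℕ i)) ⊎ (toℕ i ≡ 3 + m × toℕ j ≡ 0) →
           closeUp m d s i ~ closeUp m d s j
    edge zero    zero    (inj₁ ())
    edge zero    zero    (inj₂ (() , _))
    edge zero    (suc j) (inj₁ j+1≡1) = subst (λ x → d ~ s x) (sym (suc-injective j+1≡1)) d~first
    edge zero    (suc j) (inj₂ (() , _))
    edge (suc i) zero    (inj₁ ())
    edge (suc i) zero    (inj₂ (i+1≡ , _)) =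
      ~-sym (subst (λ x → d ~ s x) (sym (suc-injective i+1≡)) d~last)
    edge (suc i) (suc j) (inj₁ j+1≡) =
      subst (λ x → s (toℕ i) ~ s x) (sym (suc-injective j+1≡))
            (linked (subst (_≤ 2 + m) (suc-injective j+1≡) (toℕ≤ j)))
    edge (suc i) (suc j) (inj₂ (_ , ()))
    fromCycle : ∀ i j → CycAdj G m i j → closeUp m d s i ~ closeUp m d s j
    fromCycle i j (inj₁ e) = edge i j (Equivalence.to (consec⇔ m i j) e)
    fromCycle i j (inj₂ e) = ~-sym (edge j i (Equivalence.to (consec⇔ m j i) e))

  hatOnClosedPath : ∀ {m s d v} → v ≢ d → Off v s (2 + m) → v ~ d → v ~ s 0 →
    (∀ {i} → 0 < i → i ≤ 2 + m → ¬ v ~ s i) → IsHat G m (closeUp m d s) v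
  hatOnClosedPath {m} {s} {d} {v} v≢d off v~d v~s₀ onlyFirst =
    offCycle , zero , suc zero , refl , v~d , v~s₀ , onlyTwo
    where
    offCycle : ∀ l → v ≢ closeUp m d s l
    offCycle zero    = v≢d
    offCycle (suc l) = off (toℕ≤ l)
    onlyTwo : ∀ l → v ~ closeUp m d s l → (l ≡ zero) ⊎ (l ≡ suc zero)
    onlyTwo zero             _ = inj₁ refl
    onlyTwo (suc zero)       _ = inj₂ refl
    onlyTwo (suc (suc l))    a = ⊥-elim (onlyFirst (s≤s z≤n) (toℕ≤ (suc l)) a)

  squareWithHat : ∀ {a b c d v} → a ~ b → b ~ c → c ~ d → d ~ a → NonAdj G a c → NonAdj G b d →
                  v ~ a → v ~ b → ¬ v ~ c → ¬ v ~ d → HasHoleWithHat G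
  squareWithHat {a} {b} {c} {d} {v} ab bc cd da (a≢c , ¬ac) (b≢d , ¬bd) va vb ¬vc ¬vd =
    0 , closeUp 0 a bcd , v ,
    closedPathIsHole (threePath bc cd (b≢d , ¬bd)) offA ab (~-sym da) ¬a~inner ,
    hatOnClosedPath (~⇒≢ va) offV va vb onlyB
    where
    bcd : ℕ → V G
    bcd = b ◂ c ◂ λ _ → d
    offA : Off a bcd 2
    offA {zero}        _ = ~⇒≢ ab
    offA {suc zero}    _ = a≢c
    offA {suc (suc _)} _ = ~⇒≢ (~-sym da)
    ¬a~inner : ∀ {i} → 0 < i → i < 2 → ¬ a ~ bcd i
    ¬a~inner {suc zero}    _ _ = ¬ac
    ¬a~inner {suc (suc _)} _ (s≤s (s≤s ()))
    offV : Off v bcd 2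
    offV {zero}        _ = ~⇒≢ vb
    offV {suc zero}    _ v≡c = ¬ac (~-sym (subst (_~ a) v≡c va))
    offV {suc (suc _)} _ v≡d = ¬bd (~-sym (subst (_~ b) v≡d vb))
    onlyB : ∀ {i} → 0 < i → i ≤ 2 → ¬ v ~ bcd i
    onlyB {suc zero}    _ _ = ¬vc
    onlyB {suc (suc _)} _ _ = ¬vd

  -- A vertex d off an induced path that sees r a and r (a+1), misses
  -- r (a+2), …, r (a+b+2) and sees r (a+b+3) closes r (a+1), …, r (a+b+3)
  -- into a hole of length b + 4, on which r a is a hat.
  gapHat : ∀ {r L d a b} → InducedPath r L → Off d r L → 2 + b + suc a ≤ L →
           d ~ r a → d ~ r (suc a) → (∀ {i} → 0 < i → i < 2 + b → ¬ d ~ r (i + suc a)) →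
           d ~ r (2 + b + suc a) → HasHoleWithHat G
  gapHat {r} {L} {d} {a} {b} π off fits d~ra d~ra+1 gap d~end =
    b , closeUp b d (λ i → r (i + suc a)) , r a ,
    closedPathIsHole (segment π fits) (λ i≤ → off (inside i≤)) d~ra+1 d~end gap ,
    hatOnClosedPath (λ e → off (<⇒≤ a<L) (sym e)) offHat (~-sym d~ra) (linked a<L) onlyNext
    where
    open InducedPath π
    inside : ∀ {i} → i ≤ 2 + b → i + suc a ≤ L
    inside i≤ = ≤-trans (+-monoˡ-≤ (suc a) i≤) fits
    a<L : a < L
    a<L = inside z≤n
    offHat : Off (r a) (λ i → r (i + suc a)) (2 + b)
    offHat {i} i≤ e = <-irrefl (distinct (<⇒≤ a<L) (inside i≤) e) (m≤n+m (suc a) i)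
    onlyNext : ∀ {i} → 0 < i → i ≤ 2 + b → ¬ r a ~ r (i + suc a)
    onlyNext {suc i} _ i≤ a~ =
      <-irrefl (sym (suc-injective (chordless (m≤n+m (suc a) (suc i)) (inside i≤) a~))) (m≤n+m (suc a) i)

  -- If d, off an induced path, sees r a and r (1 + a) but not r (2 + a), and
  -- sees the last vertex r (suc K), then the first later neighbour of d ends a gap.
  runThenGap : ∀ {r K d a} → InducedPath r (suc K) → Off d r (suc K) → 2 + a ≤ K →
               d ~ r a → d ~ r (suc a) → ¬ d ~ r (2 + a) → d ~ r (suc K) → HasHoleWithHat G
  runThenGap {r} {K} {d} {a} π off a+2≤K d~ra d~ra+1 ¬d~ra+2 d~last =
    finish (least (λ l → d ~? r (2 + l + suc a)) d~end)
    where
    span : ℕ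
    span = K ∸ (2 + a)
    toEnd : 2 + span + suc a ≡ suc K
    toEnd = cong suc (trans (sym (+-suc span (suc a))) (m∸n+n≡m a+2≤K))
    d~end : d ~ r (2 + span + suc a)
    d~end = subst (λ x → d ~ r x) (sym toEnd) d~last
    finish : (∃ λ b → b ≤ span × d ~ r (2 + b + suc a) × (∀ {j} → j < b → ¬ d ~ r (2 + j + suc a))) →
             HasHoleWithHat G
    finish (b , b≤span , d~rb , between) = gapHat π off fits d~ra d~ra+1 gap d~rb
      where
      fits : 2 + b + suc a ≤ suc K
      fits = subst (2 + b + suc a ≤_) toEnd (+-monoˡ-≤ (suc a) (s≤s (s≤s b≤span)))
      gap : ∀ {i} → 0 < i → i < 2 + b → ¬ d ~ r (i + suc a)
      gap {suc zero}    _ _  = ¬d~ra+2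
      gap {suc (suc j)} _ j< = between (≤-pred (≤-pred j<))

  -- A vertex d off an induced path r 0, …, r (suc K) that sees r 0, r 1 and
  -- r (suc K) but not r K creates a hole with a hat: after the first run of
  -- neighbours ends, the next neighbour closes a hole.
  reentryHat : ∀ {r K d} → InducedPath r (suc K) → Off d r (suc K) →
               d ~ r 0 → d ~ r 1 → ¬ d ~ r K → d ~ r (suc K) → HasHoleWithHat G
  reentryHat {r} {K} {d} π off d~r₀ d~r₁ ¬d~rK d~last with least (λ l → ¬? (d ~? r l)) ¬d~rK
  ... | zero , _ , ¬d~r₀ , _ = ⊥-elim (¬d~r₀ d~r₀)
  ... | suc zero , _ , ¬d~r₁ , _ = ⊥-elim (¬d~r₁ d~r₁)
  ... | suc (suc a) , a+2≤K , ¬d~ra+2 , before =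
    runThenGap π off a+2≤K (seen (m<n⇒m<1+n (n<1+n a))) (seen (n<1+n (suc a))) ¬d~ra+2 d~last
    where
    seen : ∀ {j} → j < 2 + a → d ~ r j
    seen {j} j< = decidable-stable (d ~? r j) (before j<)

  record InducedPathIn (Y : V G → Set) (u v : V G) : Set where
    field
      len        : ℕ
      vertex     : ℕ → V G
      induced    : InducedPath vertex len
      start      : vertex 0 ≡ u
      end        : vertex len ≡ v
      afterStart : ∀ {i} → 0 < i → i ≤ len → Y (vertex i)

  stay : ∀ {Y} u → InducedPathIn Y u u
  stay u = record
    { len = 0 ; vertex = λ _ → u ; induced = trivialPath u ; start = refl ; end = refl
    ; afterStart = λ 0<i i≤0 → ⊥-elim (<⇒≱ 0<i i≤0) }

  -- Prepending an edge u w to an induced path from w: cut the path at its last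
  -- vertex equal or adjacent to u.
  prepend : ∀ {Y u w v} → u ~ w → Y w → InducedPathIn Y w v → InducedPathIn Y u v
  prepend {Y} {u} {w} {v} uw Yw π = cut (lastWitness meets? (inj₂ u~first) len)
    where
    open InducedPathIn π
    Meets : ℕ → Set
    Meets i = (u ≡ vertex i) ⊎ (u ~ vertex i)
    meets? : Decidable Meets
    meets? i = (u ≟ᶠ vertex i) ⊎-dec (u ~? vertex i)
    u~first : u ~ vertex 0
    u~first = subst (u ~_) (sym start) uw
    everywhere : ∀ {i} → i ≤ len → Y (vertex i)
    everywhere {zero}  _  = subst Y (sym start) Yw
    everywhere {suc i} i≤ = afterStart (s≤s z≤n) i≤
    cut : (∃ λ j → j ≤ len × Meets j × (∀ {i} → j < i → i ≤ len → ¬ Meets i)) → InducedPathIn Y u v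
    cut (j , j≤len , meets , none) = atCut meets
      where
      rest : ℕ → V G
      rest i = vertex (i + j)
      inRest : ∀ {i} → i ≤ len ∸ j → i + j ≤ len
      inRest i≤ = ≤-trans (+-monoˡ-≤ j i≤) (≤-reflexive (m∸n+n≡m j≤len))
      restPath : InducedPath rest (len ∸ j)
      restPath = segment induced (≤-reflexive (m∸n+n≡m j≤len))
      restEnd : rest (len ∸ j) ≡ v
      restEnd = trans (cong vertex (m∸n+n≡m j≤len)) end
      beyond : ∀ i → j < suc i + j
      beyond i = s≤s (m≤n+m j i)
      atCut : Meets j → InducedPathIn Y u v
      atCut (inj₁ u≡) = record
        { len = len ∸ j ; vertex = rest ; induced = restPath ; start = sym u≡ ; end = restEnd
        ; afterStart = λ _ i≤ → everywhere (inRest i≤) }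
      atCut (inj₂ u~) = record
        { len = suc (len ∸ j) ; vertex = u ◂ rest ; induced = extend restPath offU u~ onlyFirst
        ; start = refl ; end = restEnd ; afterStart = after }
        where
        offU : Off u rest (len ∸ j)
        offU {zero}  _  = ~⇒≢ u~
        offU {suc i} i≤ e = none (beyond i) (inRest i≤) (inj₁ e)
        onlyFirst : ∀ {i} → 0 < i → i ≤ len ∸ j → ¬ u ~ rest i
        onlyFirst {suc i} _ i≤ a = none (beyond i) (inRest i≤) (inj₂ a)
        after : ∀ {i} → 0 < i → i ≤ suc (len ∸ j) → Y ((u ◂ rest) i)
        after {suc i} _ i≤ = everywhere (inRest (≤-pred i≤))

module Proof (G : Graph) (hwf : HoleWithHatFree G) (C D : Subset (Graph.n G))
  (C∩D : Disjoint G C D) (C–D : CompleteSets G C D)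
  (Cconn : Connected G C) (Canti : Anticonnected G C) (Danti : Anticonnected G D)
  (P : Subgraph G) (P∩C : Disjoint G (Subgraph.VP P) C) (P∩D : Disjoint G (Subgraph.VP P) D)
  (noneComplete : ∀ p → p ∈ Subgraph.VP P → ¬ CompleteTo G p C) where
  open GraphFacts G
  open Subgraph P using (VP; EP; EP⊆)

  Fresh : V G → Set
  Fresh x = x ∈ VP × ¬ HasNbrIn G x C

  record Approach (r : ℕ → V G) (k : ℕ) : Set where
    field
      induced : InducedPath r k
      inP     : ∀ {i} → i ≤ k → r i ∈ VP
      touches : HasNbrIn G (r 0) C
      fresh   : ∀ {i} → 0 < i → i ≤ k → ¬ HasNbrIn G (r i) C

  truncate : ∀ {r k} → Approach r (suc k) → Approach r k
  truncate {k = k} α = record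
    { induced = shorten induced (n≤1+n k) ; inP = λ i≤ → inP (m≤n⇒m≤1+n i≤)
    ; touches = touches ; fresh = λ 0<i i≤ → fresh 0<i (m≤n⇒m≤1+n i≤) }
    where open Approach α

  offApproach : ∀ {r k X x} → Approach r k → Disjoint G VP X → x ∈ X → Off x r k
  offApproach {r} {X = X} α disjoint x∈X i≤ x≡ =
    disjoint (r _) (Approach.inP α i≤) (subst (_∈ X) x≡ x∈X)

  splitMixed : ∀ {v} → MixedOn G v D → BoundaryEdge (NonAdj G) D v
  splitMixed {v} (_ , incomplete , ¬anti) =
    boundaryEdge (NonAdj G) D Danti v (someNeighbour v D ¬anti) incomplete

  -- A vertex of P with a neighbour in C is not mixed on D: a 4-hole
  -- alternating between C and D would carry it as a hat.
  startNotMixed : ∀ {p} → p ∈ VP → HasNbrIn G p C → ¬ MixedOn G p D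
  startNotMixed {p} p∈P p~C mixed
    with boundaryEdge (NonAdj G) C Canti p p~C (noneComplete p p∈P) | splitMixed mixed
  ... | c₁ , c₂ , c₁∈ , c₂∈ , pc₁ , ¬pc₂ , c₁c₂ | d₁ , d₂ , d₁∈ , d₂∈ , pd₁ , ¬pd₂ , d₁d₂ =
    hwf (squareWithHat (C–D c₁ d₁ c₁∈ d₁∈) (~-sym (C–D c₂ d₁ c₂∈ d₁∈)) (C–D c₂ d₂ c₂∈ d₂∈)
                       (~-sym (C–D c₁ d₂ c₁∈ d₂∈)) c₁c₂ d₁d₂ pc₁ pd₁ ¬pc₂ ¬pd₂)

  -- Last step of an approach, when r k sees the neighbour d₁ of r (suc k):
  -- r k is complete to D, and r k d₁ c₀ d₂ is a 4-hole with hat r (suc k).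
  previousSees : ∀ {r k d₁ d₂} → Approach r (suc k) → ¬ MixedOn G (r k) D → d₁ ∈ D → d₂ ∈ D →
                 r (suc k) ~ d₁ → ¬ r (suc k) ~ d₂ → NonAdj G d₁ d₂ → r k ~ d₁ → ⊥
  previousSees {r} {k} {d₁} {d₂} α prevNotMixed d₁∈ d₂∈ rd₁ ¬rd₂ d₁d₂ prev~d₁ = byD₂ (r k ~? d₂)
    where
    open Approach α
    open InducedPath induced
    prev∈P : r k ∈ VP
    prev∈P = inP (n≤1+n k)
    byD₂ : Dec (r k ~ d₂) → ⊥
    byD₂ (no ¬prev~d₂) =
      prevNotMixed (P∩D (r k) prev∈P , (λ complete → ¬prev~d₂ (complete d₂ d₂∈)) ,
                    λ anticomplete → anticomplete d₁ d₁∈ prev~d₁)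
    byD₂ (yes prev~d₂) with missedVertex (r k) C (noneComplete (r k) prev∈P)
    ... | c₀ , c₀∈ , ¬prev~c₀ =
      hwf (squareWithHat prev~d₁ (~-sym (C–D c₀ d₁ c₀∈ d₁∈)) (C–D c₀ d₂ c₀∈ d₂∈) (~-sym prev~d₂)
                         ((λ e → offApproach α P∩C c₀∈ (n≤1+n k) (sym e)) , ¬prev~c₀) d₁d₂
                         (~-sym (linked ≤-refl)) rd₁ (λ a → fresh (s≤s z≤n) ≤-refl (c₀ , c₀∈ , a)) ¬rd₂)

  -- Last step of an approach, when r k misses the neighbour d₁ of r (suc k):
  -- prefix an edge c' c of C with c ∈ N(r 0), c' ∉ N(r 0); along the induced
  -- path c', c, r 0, …, r (suc k) the vertex d₁ re-enters its neighbourhood.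
  previousMisses : ∀ {r k d₁} → Approach r (suc k) → d₁ ∈ D → r (suc k) ~ d₁ → ¬ r k ~ d₁ → ⊥
  previousMisses {r} {k} {d₁} α d₁∈ rd₁ ¬prev~d₁
    with boundaryEdge (Adj G) C Cconn (r 0) (Approach.touches α)
                      (noneComplete (r 0) (Approach.inP α z≤n))
  ... | c , c' , c∈ , c'∈ , r₀c , ¬r₀c' , cc' =
    hwf (reentryHat longPath offD (~-sym (C–D c' d₁ c'∈ d₁∈)) (~-sym (C–D c d₁ c∈ d₁∈))
                    (λ a → ¬prev~d₁ (~-sym a)) (~-sym rd₁))
    where
    open Approach α
    throughC : InducedPath (c ◂ r) (suc (suc k))
    throughC = extend induced (offApproach α P∩C c∈) (~-sym r₀c)
                      (λ 0<i i≤ a → fresh 0<i i≤ (c , c∈ , ~-sym a))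
    offC' : Off c' (c ◂ r) (suc (suc k))
    offC' {zero}  _  = ~⇒≢ (~-sym cc')
    offC' {suc i} i≤ = offApproach α P∩C c'∈ (≤-pred i≤)
    onlyC : ∀ {i} → 0 < i → i ≤ suc (suc k) → ¬ c' ~ (c ◂ r) i
    onlyC {suc zero}    _ _  a = ¬r₀c' (~-sym a)
    onlyC {suc (suc i)} _ i≤ a = fresh (s≤s z≤n) (≤-pred i≤) (c' , c'∈ , ~-sym a)
    longPath : InducedPath (c' ◂ c ◂ r) (suc (suc (suc k)))
    longPath = extend throughC offC' (~-sym cc') onlyC
    offD : Off d₁ (c' ◂ c ◂ r) (suc (suc (suc k)))
    offD {zero}        _  d₁≡ = C∩D c' c'∈ (subst (_∈ D) d₁≡ d₁∈)
    offD {suc zero}    _  d₁≡ = C∩D c c∈ (subst (_∈ D) d₁≡ d₁∈)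
    offD {suc (suc i)} i≤ = offApproach α P∩D d₁∈ (≤-pred (≤-pred i≤))

  endNotMixed : ∀ k {r} → Approach r k → ¬ MixedOn G (r k) D
  endNotMixed zero α = startNotMixed (inP z≤n) touches
    where open Approach α
  endNotMixed (suc k) {r} α mixed with splitMixed mixed
  ... | d₁ , d₂ , d₁∈ , d₂∈ , rd₁ , ¬rd₂ , d₁d₂ with r k ~? d₁
  ...   | yes prev~d₁ = previousSees α (endNotMixed k (truncate α)) d₁∈ d₂∈ rd₁ ¬rd₂ d₁d₂ prev~d₁
  ...   | no ¬prev~d₁ = previousMisses α d₁∈ rd₁ ¬prev~d₁

  approach : ∀ {w v} → w ∈ VP → HasNbrIn G w C → (π : InducedPathIn Fresh w v) →
             Approach (InducedPathIn.vertex π) (InducedPathIn.len π)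
  approach w∈P w~C π = record
    { induced = induced
    ; inP     = inP
    ; touches = subst (λ x → HasNbrIn G x C) (sym start) w~C
    ; fresh   = λ 0<i i≤ → proj₂ (afterStart 0<i i≤) }
    where
    open InducedPathIn π
    inP : ∀ {i} → i ≤ len → vertex i ∈ VP
    inP {zero}  _  = subst (_∈ VP) (sym start) w∈P
    inP {suc i} i≤ = proj₁ (afterStart (s≤s z≤n) i≤)

  Entry : V G → Set
  Entry v = ∃ λ w → w ∈ VP × HasNbrIn G w C × InducedPathIn Fresh w v

  entry : ∀ {u v} → PathIn G EP VP u v → Entry v ⊎ InducedPathIn Fresh u v
  entry {u} here = inj₂ (stay u)
  entry (step {w = w} uw w∈P rest) with entry rest
  ... | inj₁ found = inj₁ found
  ... | inj₂ π with hasNbr? w C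
  ...   | yes w~C  = inj₁ (w , w∈P , w~C , π)
  ...   | no ¬w~C = inj₂ (prepend (EP⊆ uw) (w∈P , ¬w~C) π)

  endOfFreshPath : ∀ {w v} → w ∈ VP → HasNbrIn G w C → InducedPathIn Fresh w v → ¬ MixedOn G v D
  endOfFreshPath w∈P w~C π = subst (λ x → ¬ MixedOn G x D) (InducedPathIn.end π)
                                   (endNotMixed (InducedPathIn.len π) (approach w∈P w~C π))

  theorem : ∀ {p₀ p} → p₀ ∈ VP → HasNbrIn G p₀ C → PathIn G EP VP p₀ p → ¬ MixedOn G p D
  theorem p₀∈P p₀~C walk with entry walk
  ... | inj₁ (w , w∈P , w~C , π) = endOfFreshPath w∈P w~C π
  ... | inj₂ π                   = endOfFreshPath p₀∈P p₀~C π

mainTheorem7 : (G : Graph) → HoleWithHatFree G →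
    (C D : Subset (Graph.n G)) →
    Nonempty G C → Nonempty G D → Disjoint G C D → CompleteSets G C D →
    Connected G C → Anticonnected G C → Anticonnected G D →
    (P : Subgraph G) → SubgraphConnected G P →
    Disjoint G (Subgraph.VP P) C → Disjoint G (Subgraph.VP P) D →
    (∃ λ p → p ∈ Subgraph.VP P × HasNbrIn G p C) →
    (∀ p → p ∈ Subgraph.VP P → ¬ CompleteTo G p C) →
    ∀ p → p ∈ Subgraph.VP P → ¬ MixedOn G p D
mainTheorem7 G hwf C D _ _ C∩D C–D Cconn Canti Danti P Pconn P∩C P∩D (p₀ , p₀∈P , p₀~C) noneComplete p p∈P =
  Proof.theorem G hwf C D C∩D C–D Cconn Canti Danti P P∩C P∩D noneComplete p₀∈P p₀~C
                (Pconn p₀ p p₀∈P p∈P)
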